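{- Let $1\le m\le n$ and $0\le k\le n-1$ be integers. The total number of ties over all elements of $B(m,n;k)$ equals the total number of ties over all elements of $PF(m,n)$, i.e. $$\sum_{f\in B(m,n;k)}\mathrm{ties}(f)=\sum_{g\in PF(m,n)}\mathrm{ties}(g).$$
   Context: Parking lot: the directed path with vertices $1,\dots,n$; a tuple $(a_1,\dots,a_m)\in[n]^m$ gives the preferences of cars $c_1,\dots,c_m$ arriving in order. $PF(m,n)$: tuples for which all cars park under the classical rule (park at $a_j$ if free, otherwise at the first free vertex after $a_j$; fail if none). $k$-Naples rule: car $c_j$ parks at $a_j$ if free; otherwise, if some vertex of $\{a_j-1,\dots,a_j-k\}\cap[n]$ is free, it parks at the free one closest to $a_j$; otherwise it parks at the first free vertex after $a_j$ (failing if none). $PF(m,n;k)$ is the set of tuples for which all cars park. $B(m,n;k)$ is the subset of $PF(m,n;k)$ consisting of tuples such that whenever $a_i\le k$, some vertex of $\{1,\dots,a_i\}$ is not occupied by any of $c_1,\dots,c_{i-1}$. For a tuple $(a_1,\dots,a_m)$, a tie is an index $j\in[m-1]$ with $a_j=a_{j+1}$; $\mathrm{ties}(f)$ is the number of ties of $f$. -}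

module Defs where

open import Data.Nat using (ℕ; zero; suc; _+_; _∸_; _≤ᵇ_; _≡ᵇ_)
open import Data.Bool using (Bool; true; false; if_then_else_; _∧_; _∨_; not)
open import Data.List using (List; []; _∷_; map; concatMap; _++_)
open import Data.Maybe using (Maybe; just; nothing; _>>=_)

-- Vertices of the directed path are 1, ..., n.
-- An occupancy state is a function  ℕ → Bool  (true = occupied); only vertices
-- in 1..n are ever consulted or set.

Occ : Set
Occ = ℕ → Bool

emptyOcc : Occ
emptyOcc _ = false

occupy : ℕ → Occ → Occ
occupy v o w = if w ≡ᵇ v then true else o w

inPath : ℕ → ℕ → Bool
inPath n v = (1 ≤ᵇ v) ∧ (v ≤ᵇ n)

freeAt : ℕ → Occ → ℕ → Bool
freeAt n o v = inPath n v ∧ not (o v)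

firstFreeFrom : ℕ → Occ → ℕ → ℕ → Maybe ℕ
firstFreeFrom n o a zero = nothing
firstFreeFrom n o a (suc fuel) =
  if freeAt n o a then just a else firstFreeFrom n o (suc a) fuel

parkClassical : ℕ → Occ → ℕ → Maybe ℕ
parkClassical n o a = firstFreeFrom n o a (suc n)

backFree : ℕ → Occ → ℕ → ℕ → ℕ → Maybe ℕ
backFree n o a zero d = nothing
backFree n o a (suc j) d =
  if (d ≤ᵇ a ∸ 1) ∧ freeAt n o (a ∸ d) then just (a ∸ d) else backFree n o a j (suc d)

parkNaples : ℕ → ℕ → Occ → ℕ → Maybe ℕ
parkNaples n k o a with freeAt n o a
... | true  = just a
... | false with backFree n o a k 1
...   | just v  = just v
...   | nothing = parkClassical n o a

runRule : (Occ → ℕ → Maybe ℕ) → Occ → List ℕ → Maybe Occ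
runRule rule o [] = just o
runRule rule o (a ∷ as) = rule o a >>= λ v → runRule rule (occupy v o) as

isJust : {A : Set} → Maybe A → Bool
isJust (just _) = true
isJust nothing  = false

isPF : ℕ → List ℕ → Bool
isPF n f = isJust (runRule (parkClassical n) emptyOcc f)

isPFk : ℕ → ℕ → List ℕ → Bool
isPFk n k f = isJust (runRule (parkNaples n k) emptyOcc f)

someFreeUpTo : Occ → ℕ → Bool
someFreeUpTo o zero = false
someFreeUpTo o (suc v) = not (o (suc v)) ∨ someFreeUpTo o v

-- the extra condition of B(m,n;k): whenever a_i ≤ k, some vertex of {1..a_i}
-- is unoccupied by c_1..c_{i-1}  (checked along the k-Naples process)
bCond : ℕ → ℕ → Occ → List ℕ → Bool
bCond n k o [] = true
bCond n k o (a ∷ as) with parkNaples n k o a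
... | nothing = false
... | just v  = (not (a ≤ᵇ k) ∨ someFreeUpTo o a) ∧ bCond n k (occupy v o) as

isB : ℕ → ℕ → List ℕ → Bool
isB n k f = isPFk n k f ∧ bCond n k emptyOcc f

range1 : ℕ → List ℕ
range1 zero = []
range1 (suc n) = range1 n ++ (suc n ∷ [])

tuples : ℕ → ℕ → List (List ℕ)
tuples zero n = [] ∷ []
tuples (suc m) n = concatMap (λ a → map (a ∷_) (tuples m n)) (range1 n)

ties : List ℕ → ℕ
ties [] = 0
ties (a ∷ []) = 0
ties (a ∷ b ∷ as) = (if a ≡ᵇ b then 1 else 0) + ties (b ∷ as)

sumTiesOver : (List ℕ → Bool) → List (List ℕ) → ℕ
sumTiesOver P [] = 0
sumTiesOver P (f ∷ fs) = (if P f then ties f else 0) + sumTiesOver P fs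

tiesPF : ℕ → ℕ → ℕ
tiesPF m n = sumTiesOver (isPF n) (tuples m n)

tiesB : ℕ → ℕ → ℕ → ℕ
tiesB m n k = sumTiesOver (isB n k) (tuples m n)

module Submission where

open import Defs
open import Algebra.Properties.CommutativeSemigroup using (interchange)
open import Data.Bool using (Bool; true; false; if_then_else_; _∧_; _∨_; not; T)
open import Data.Bool.Properties using (∨-zeroʳ; ∧-zeroʳ; ∧-idem)
open import Data.Empty using (⊥-elim)
open import Data.List using (List; []; _∷_; _++_; map; concatMap; length)
open import Data.List.Properties using (map-++)
open import Data.List.Membership.Propositional using (_∈_)
open import Data.List.Relation.Unary.All as All using (All; []; _∷_; lookupAny)
open import Data.List.Relation.Unary.All.Properties using (concat⁺; map⁺)
open import Data.List.Relation.Unary.Any using (Any; here; there)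
open import Data.Maybe using (Maybe; just; nothing; fromMaybe; maybe′; _<∣>_) renaming (map to mapMaybe)
open import Data.Nat using (ℕ; zero; suc; _+_; _*_; _∸_; _≤_; _<_; z≤n; s≤s; _≤ᵇ_; _≡ᵇ_; _≤?_; _≟_)
open import Data.Nat.Properties
open import Data.Product using (_×_; _,_; proj₁; proj₂; Σ-syntax)
open import Data.Sum using (inj₁; inj₂)
open import Data.Unit using (tt)
open import Function using (_∘_)
open import Relation.Nullary using (¬_; yes; no; contradiction)
open import Relation.Binary.PropositionalEquality

-- Run the k-Naples rule on a cycle with vertices 1, …, n + 1, both searches
-- wrapping around between 1 and n + 1.  For a tuple in [n]^m, the path rule
-- succeeds and the condition of B(m,n;k) holds exactly when vertex n + 1 is still
-- empty at the end, while tuples using the value n + 1 always fill that vertex;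
-- so Σ_{B(m,n;k)} ties counts, weighted by ties, the tuples of [n+1]^m that leave
-- vertex n + 1 empty.  The cyclic rule commutes with rotating the preferences,
-- which preserves ties, so the same number is obtained for every vertex.  Every
-- car parks on the cycle, so summing over the n + 1 vertices gives n + 1 times
-- that number as Σ_t ties(t) (n + 1 − m), independently of k.  Finally
-- B(m,n;0) = PF(m,n).

¬T⇒≡false : ∀ {b} → ¬ T b → b ≡ false
¬T⇒≡false {false} _ = refl
¬T⇒≡false {true} ¬t = ⊥-elim (¬t tt)

T⇒≡true : ∀ {b} → T b → b ≡ true
T⇒≡true {true} _ = refl

≡ᵇ-true : ∀ {m n} → m ≡ n → (m ≡ᵇ n) ≡ true
≡ᵇ-true {m} {n} = T⇒≡true ∘ ≡⇒≡ᵇ m n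

≡ᵇ-false : ∀ {m n} → m ≢ n → (m ≡ᵇ n) ≡ false
≡ᵇ-false {m} {n} m≢n = ¬T⇒≡false (m≢n ∘ ≡ᵇ⇒≡ m n)

≤ᵇ-true : ∀ {m n} → m ≤ n → (m ≤ᵇ n) ≡ true
≤ᵇ-true = T⇒≡true ∘ ≤⇒≤ᵇ

≤ᵇ-false : ∀ {m n} → ¬ m ≤ n → (m ≤ᵇ n) ≡ false
≤ᵇ-false {m} {n} m≰n = ¬T⇒≡false (m≰n ∘ ≤ᵇ⇒≤ m n)

-- Finite sums

private variable A B : Set

sumOver : List A → (A → ℕ) → ℕ
sumOver [] h = 0
sumOver (x ∷ xs) h = h x + sumOver xs h

sumOver-cong : ∀ (xs : List A) {h h′} → (∀ x → h x ≡ h′ x) → sumOver xs h ≡ sumOver xs h′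
sumOver-cong [] eq = refl
sumOver-cong (x ∷ xs) eq = cong₂ _+_ (eq x) (sumOver-cong xs eq)

sumOver-cong-local : ∀ {P : A → Set} {xs h h′} → All P xs → (∀ {x} → P x → h x ≡ h′ x) →
                     sumOver xs h ≡ sumOver xs h′
sumOver-cong-local [] eq = refl
sumOver-cong-local (px ∷ pxs) eq = cong₂ _+_ (eq px) (sumOver-cong-local pxs eq)

sumOver-mono-≤ : ∀ (xs : List A) {h h′} → (∀ x → h x ≤ h′ x) → sumOver xs h ≤ sumOver xs h′
sumOver-mono-≤ [] le = z≤n
sumOver-mono-≤ (x ∷ xs) le = +-mono-≤ (le x) (sumOver-mono-≤ xs le)

sumOver-zero : ∀ (xs : List A) → sumOver xs (λ _ → 0) ≡ 0
sumOver-zero [] = refl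
sumOver-zero (x ∷ xs) = sumOver-zero xs

sumOver-nonzero : ∀ (xs : List A) h → sumOver xs h ≢ 0 → Any (λ x → h x ≢ 0) xs
sumOver-nonzero [] h ne = contradiction refl ne
sumOver-nonzero (x ∷ xs) h ne with h x ≟ 0
... | no hx≢0 = here hx≢0
... | yes hx≡0 = there (sumOver-nonzero xs h λ s≡0 → ne (trans (cong (_+ sumOver xs h) hx≡0) s≡0))

sumOver-++ : ∀ (xs ys : List A) h → sumOver (xs ++ ys) h ≡ sumOver xs h + sumOver ys h
sumOver-++ [] ys h = refl
sumOver-++ (x ∷ xs) ys h = trans (cong (h x +_) (sumOver-++ xs ys h)) (sym (+-assoc (h x) _ _))

sumOver-+ : ∀ (xs : List A) f g → sumOver xs (λ x → f x + g x) ≡ sumOver xs f + sumOver xs g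
sumOver-+ [] f g = refl
sumOver-+ (x ∷ xs) f g =
  trans (cong (f x + g x +_) (sumOver-+ xs f g)) (interchange +-commutativeSemigroup (f x) (g x) _ _)

sumOver-*ˡ : ∀ (xs : List A) c f → sumOver xs (λ x → c * f x) ≡ c * sumOver xs f
sumOver-*ˡ [] c f = sym (*-zeroʳ c)
sumOver-*ˡ (x ∷ xs) c f = trans (cong (c * f x +_) (sumOver-*ˡ xs c f)) (sym (*-distribˡ-+ c (f x) _))

sumOver-map : ∀ (f : B → A) xs h → sumOver (map f xs) h ≡ sumOver xs (h ∘ f)
sumOver-map f [] h = refl
sumOver-map f (x ∷ xs) h = cong (h (f x) +_) (sumOver-map f xs h)

sumOver-concatMap : ∀ (f : B → List A) xs h →
                    sumOver (concatMap f xs) h ≡ sumOver xs (λ x → sumOver (f x) h)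
sumOver-concatMap f [] h = refl
sumOver-concatMap f (x ∷ xs) h =
  trans (sumOver-++ (f x) (concatMap f xs) h) (cong (sumOver (f x) h +_) (sumOver-concatMap f xs h))

sumOver-swap : ∀ (xs : List A) (ys : List B) (h : A → B → ℕ) →
               sumOver xs (λ x → sumOver ys (h x)) ≡ sumOver ys (λ y → sumOver xs (λ x → h x y))
sumOver-swap [] ys h = sym (sumOver-zero ys)
sumOver-swap (x ∷ xs) ys h =
  trans (cong (sumOver ys (h x) +_) (sumOver-swap xs ys h))
        (sym (sumOver-+ ys (h x) (λ y → sumOver xs (λ x′ → h x′ y))))

InRange : ℕ → ℕ → Set
InRange N v = 1 ≤ v × v ≤ N

InRange⇒1≤N : ∀ {N v} → InRange N v → 1 ≤ N
InRange⇒1≤N (1≤v , v≤N) = ≤-trans 1≤v v≤N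

range1-suc : ∀ n → range1 (suc n) ≡ 1 ∷ map suc (range1 n)
range1-suc zero = refl
range1-suc (suc n) =
  trans (cong (_++ suc (suc n) ∷ []) (range1-suc n)) (cong (1 ∷_) (sym (map-++ suc (range1 n) _)))

range1-inRange : ∀ N → All (InRange N) (range1 N)
range1-inRange zero = []
range1-inRange (suc n) rewrite range1-suc n =
  (≤-refl , s≤s z≤n) ∷ map⁺ (All.map (λ (_ , v≤n) → s≤s z≤n , s≤s v≤n) (range1-inRange n))

sumOver-range1-suc : ∀ n h → sumOver (range1 (suc n)) h ≡ h 1 + sumOver (range1 n) (h ∘ suc)
sumOver-range1-suc n h rewrite range1-suc n = cong (h 1 +_) (sumOver-map suc (range1 n) h)

sumOver-range1-snoc : ∀ n h → sumOver (range1 (suc n)) h ≡ sumOver (range1 n) h + h (suc n)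
sumOver-range1-snoc n h =
  trans (sumOver-++ (range1 n) _ h) (cong (sumOver (range1 n) h +_) (+-identityʳ _))

sumOver-range1-const : ∀ n c → sumOver (range1 n) (λ _ → c) ≡ n * c
sumOver-range1-const zero c = refl
sumOver-range1-const (suc n) c =
  trans (sumOver-range1-suc n _) (cong (c +_) (sumOver-range1-const n c))

tuples-inRange : ∀ m N → All (All (InRange N)) (tuples m N)
tuples-inRange zero N = [] ∷ []
tuples-inRange (suc m) N =
  concat⁺ (map⁺ (All.map (λ ra → map⁺ (All.map (ra ∷_) (tuples-inRange m N))) (range1-inRange N)))

sumOver-tuples-suc : ∀ m N h →
  sumOver (tuples (suc m) N) h ≡ sumOver (range1 N) (λ a → sumOver (tuples m N) (λ t → h (a ∷ t)))
sumOver-tuples-suc m N h =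
  trans (sumOver-concatMap _ (range1 N) h) (sumOver-cong (range1 N) (λ a → sumOver-map (a ∷_) (tuples m N) h))

sumOver-tuples-restrict : ∀ m n h → (∀ t → All (InRange (suc n)) t → suc n ∈ t → h t ≡ 0) →
                          sumOver (tuples m (suc n)) h ≡ sumOver (tuples m n) h
sumOver-tuples-restrict zero n h vanish = refl
sumOver-tuples-restrict (suc m) n h vanish = begin
  sumOver (tuples (suc m) (suc n)) h
    ≡⟨ sumOver-tuples-suc m (suc n) h ⟩
  sumOver (range1 (suc n)) (λ a → sumOver (tuples m (suc n)) (λ t → h (a ∷ t)))
    ≡⟨ sumOver-range1-snoc n _ ⟩
  sumOver (range1 n) (λ a → sumOver (tuples m (suc n)) (λ t → h (a ∷ t)))
    + sumOver (tuples m (suc n)) (λ t → h (suc n ∷ t))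
    ≡⟨ cong₂ _+_ (sumOver-cong-local (range1-inRange n) restrict-rest) vanish-last ⟩
  sumOver (range1 n) (λ a → sumOver (tuples m n) (λ t → h (a ∷ t))) + 0
    ≡⟨ +-identityʳ _ ⟩
  sumOver (range1 n) (λ a → sumOver (tuples m n) (λ t → h (a ∷ t)))
    ≡⟨ sym (sumOver-tuples-suc m n h) ⟩
  sumOver (tuples (suc m) n) h ∎
  where
  open ≡-Reasoning
  restrict-rest : ∀ {a} → InRange n a →
                  sumOver (tuples m (suc n)) (λ t → h (a ∷ t)) ≡ sumOver (tuples m n) (λ t → h (a ∷ t))
  restrict-rest {a} (1≤a , a≤n) = sumOver-tuples-restrict m n _ λ t rt n+1∈t →
    vanish (a ∷ t) ((1≤a , m≤n⇒m≤1+n a≤n) ∷ rt) (there n+1∈t)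
  vanish-last : sumOver (tuples m (suc n)) (λ t → h (suc n ∷ t)) ≡ 0
  vanish-last = trans (sumOver-cong-local (tuples-inRange m (suc n))
                         (λ {t} rt → vanish (suc n ∷ t) ((s≤s z≤n , ≤-refl) ∷ rt) (here refl)))
                      (sumOver-zero (tuples m (suc n)))

sumTiesOver≡sumOver : ∀ P fs → sumTiesOver P fs ≡ sumOver fs (λ t → if P t then ties t else 0)
sumTiesOver≡sumOver P [] = refl
sumTiesOver≡sumOver P (f ∷ fs) = cong (_ +_) (sumTiesOver≡sumOver P fs)

sumTiesOver-cong-local : ∀ {Q : List ℕ → Set} {P P′ fs} → All Q fs → (∀ {f} → Q f → P f ≡ P′ f) →
                         sumTiesOver P fs ≡ sumTiesOver P′ fs
sumTiesOver-cong-local [] eq = refl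
sumTiesOver-cong-local {fs = f ∷ _} (qf ∷ qfs) eq =
  cong₂ _+_ (cong (λ b → if b then ties f else 0) (eq qf)) (sumTiesOver-cong-local qfs eq)

-- The cyclic order on [N]

next : ℕ → ℕ → ℕ
next N v = if N ≤ᵇ v then 1 else suc v

prev : ℕ → ℕ → ℕ
prev N zero = N
prev N (suc zero) = N
prev N (suc (suc v)) = suc v

next-< : ∀ {N v} → v < N → next N v ≡ suc v
next-< {N} {v} v<N rewrite ≤ᵇ-false (<⇒≱ v<N) = refl

next-last : ∀ N → next N N ≡ 1
next-last N rewrite ≤ᵇ-true (≤-refl {N}) = refl

next-inRange : ∀ {N} v → 1 ≤ N → InRange N (next N v)
next-inRange {N} v 1≤N with N ≤? v
... | yes N≤v rewrite ≤ᵇ-true N≤v = ≤-refl , 1≤N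
... | no N≰v rewrite ≤ᵇ-false N≰v = s≤s z≤n , ≰⇒> N≰v

prev-inRange : ∀ {N v} → InRange N v → InRange N (prev N v)
prev-inRange {v = suc zero} (_ , 1≤N) = 1≤N , ≤-refl
prev-inRange {v = suc (suc v)} (_ , v<N) = s≤s z≤n , ≤-trans (n≤1+n _) v<N

prev-next : ∀ {N v} → InRange N v → prev N (next N v) ≡ v
prev-next {N} {v} (1≤v , v≤N) with m≤n⇒m<n∨m≡n v≤N
... | inj₂ refl rewrite next-last v = refl
... | inj₁ v<N rewrite next-< v<N with v | 1≤v
...   | suc _ | _ = refl

next-prev : ∀ {N v} → InRange N v → next N (prev N v) ≡ v
next-prev {N} {suc zero} _ = next-last N
next-prev {N} {suc (suc v)} (_ , v<N) = next-< v<N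

next-injective : ∀ {N a b} → InRange N a → InRange N b → next N a ≡ next N b → a ≡ b
next-injective ra rb eq = trans (sym (prev-next ra)) (trans (cong (prev _) eq) (prev-next rb))

next-≡ᵇ : ∀ {N a b} → InRange N a → InRange N b → (next N a ≡ᵇ next N b) ≡ (a ≡ᵇ b)
next-≡ᵇ {N} {a} {b} ra rb with a ≟ b
... | yes refl = trans (≡ᵇ-true {next N a} refl) (sym (≡ᵇ-true {a} refl))
... | no a≢b = trans (≡ᵇ-false (a≢b ∘ next-injective ra rb)) (sym (≡ᵇ-false a≢b))

advance : ℕ → ℕ → ℕ → ℕ
advance N zero v = v
advance N (suc j) v = advance N j (next N v)

advance-+ : ∀ {N} i j v → advance N (i + j) v ≡ advance N j (advance N i v)
advance-+ zero j v = refl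
advance-+ {N} (suc i) j v = advance-+ i j (next N v)

advance-≤ : ∀ {N} j v → v + j ≤ N → advance N j v ≡ v + j
advance-≤ zero v _ = sym (+-identityʳ v)
advance-≤ {N} (suc j) v v+j<N
  rewrite +-suc v j | next-< {N} {v} (≤-trans (s≤s (m≤m+n v j)) v+j<N) = advance-≤ j (suc v) v+j<N

advance-reaches : ∀ {N v w} → InRange N v → InRange N w → Σ[ j ∈ ℕ ] j < N × advance N j v ≡ w
advance-reaches {N} {v} {w} (1≤v , v≤N) (1≤w , w≤N) with v ≤? w
... | yes v≤w =
  w ∸ v , <-≤-trans (∸-monoʳ-< 1≤v v≤w) w≤N ,
  trans (advance-≤ (w ∸ v) v (subst (_≤ N) (sym (m+[n∸m]≡n v≤w)) w≤N)) (m+[n∸m]≡n v≤w)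
... | no v≰w =
  N ∸ v + w , subst (N ∸ v + w <_) (m∸n+n≡m v≤N) (+-monoʳ-< (N ∸ v) (≰⇒> v≰w)) ,
  trans (advance-+ (N ∸ v) w v) (trans (cong (advance N w) to-last) (from-last w 1≤w w≤N))
  where
  to-last : advance N (N ∸ v) v ≡ N
  to-last = trans (advance-≤ (N ∸ v) v (≤-reflexive (m+[n∸m]≡n v≤N))) (m+[n∸m]≡n v≤N)
  from-last : ∀ u → 1 ≤ u → u ≤ N → advance N u N ≡ u
  from-last (suc u) _ u<N rewrite next-last N = advance-≤ u 1 u<N

sumOver-range1-next : ∀ N h → sumOver (range1 N) (h ∘ next N) ≡ sumOver (range1 N) h
sumOver-range1-next zero h = refl
sumOver-range1-next (suc n) h = begin
  sumOver (range1 (suc n)) (h ∘ next (suc n))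
    ≡⟨ sumOver-range1-snoc n _ ⟩
  sumOver (range1 n) (h ∘ next (suc n)) + h (next (suc n) (suc n))
    ≡⟨ cong₂ _+_ (sumOver-cong-local (range1-inRange n) (λ (_ , a≤n) → cong h (next-< (s≤s a≤n))))
                 (cong h (next-last (suc n))) ⟩
  sumOver (range1 n) (h ∘ suc) + h 1
    ≡⟨ +-comm _ (h 1) ⟩
  h 1 + sumOver (range1 n) (h ∘ suc)
    ≡⟨ sym (sumOver-range1-suc n h) ⟩
  sumOver (range1 (suc n)) h ∎
  where open ≡-Reasoning

rotate : ℕ → List ℕ → List ℕ
rotate N = map (next N)

sumOver-tuples-rotate : ∀ m N h → sumOver (tuples m N) (h ∘ rotate N) ≡ sumOver (tuples m N) h
sumOver-tuples-rotate zero N h = refl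
sumOver-tuples-rotate (suc m) N h = begin
  sumOver (tuples (suc m) N) (h ∘ rotate N)
    ≡⟨ sumOver-tuples-suc m N _ ⟩
  sumOver (range1 N) (λ a → sumOver (tuples m N) (λ t → h (next N a ∷ rotate N t)))
    ≡⟨ sumOver-cong (range1 N) (λ a → sumOver-tuples-rotate m N (λ t → h (next N a ∷ t))) ⟩
  sumOver (range1 N) ((λ b → sumOver (tuples m N) (λ t → h (b ∷ t))) ∘ next N)
    ≡⟨ sumOver-range1-next N _ ⟩
  sumOver (range1 N) (λ b → sumOver (tuples m N) (λ t → h (b ∷ t)))
    ≡⟨ sym (sumOver-tuples-suc m N h) ⟩
  sumOver (tuples (suc m) N) h ∎
  where open ≡-Reasoning

ties-rotate : ∀ {N} t → All (InRange N) t → ties (rotate N t) ≡ ties t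
ties-rotate [] _ = refl
ties-rotate (a ∷ []) _ = refl
ties-rotate (a ∷ b ∷ t) (ra ∷ rb ∷ rt) =
  cong₂ _+_ (cong (λ x → if x then 1 else 0) (next-≡ᵇ ra rb)) (ties-rotate (b ∷ t) (rb ∷ rt))

-- The k-Naples rule on a cycle

occupy-self : ∀ (o : Occ) v → occupy v o v ≡ true
occupy-self o v rewrite ≡ᵇ-true {v} refl = refl

occupy-other : ∀ (o : Occ) {v w} → w ≢ v → occupy v o w ≡ o w
occupy-other o w≢v rewrite ≡ᵇ-false w≢v = refl

occupy-preserves : ∀ (o : Occ) {v w} → o v ≡ true → occupy w o v ≡ true
occupy-preserves o {v} {w} ov with v ≡ᵇ w
... | true = refl
... | false = ov

forward : ℕ → Occ → ℕ → ℕ → ℕ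
forward N o v zero = v
forward N o v (suc i) = if o v then forward N o (next N v) i else v

backward : ℕ → Occ → ℕ → ℕ → Maybe ℕ
backward N o v zero = nothing
backward N o v (suc j) = if o (prev N v) then backward N o (prev N v) j else just (prev N v)

parkCircular : ℕ → ℕ → Occ → ℕ → ℕ
parkCircular N k o a = if o a then fromMaybe (forward N o a N) (backward N o a k) else a

runCircular : ℕ → ℕ → Occ → List ℕ → Occ
runCircular N k o [] = o
runCircular N k o (a ∷ t) = runCircular N k (occupy (parkCircular N k o a) o) t

parkCircular-at-vacant : ∀ {N k} {o : Occ} {a} → o a ≡ false → parkCircular N k o a ≡ a
parkCircular-at-vacant oa rewrite oa = refl

parkCircular-at-occupied : ∀ {N k} {o : Occ} {a} → o a ≡ true →
                           parkCircular N k o a ≡ fromMaybe (forward N o a N) (backward N o a k)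
parkCircular-at-occupied oa rewrite oa = refl

forward-at-vacant : ∀ {N} {o : Occ} {v} → o v ≡ false → ∀ i → forward N o v i ≡ v
forward-at-vacant ov zero = refl
forward-at-vacant ov (suc i) rewrite ov = refl

forward-inRange : ∀ {N o} i v → InRange N v → InRange N (forward N o v i)
forward-inRange zero v rv = rv
forward-inRange {N} {o} (suc i) v rv with o v
... | true = forward-inRange i (next N v) (next-inRange v (InRange⇒1≤N rv))
... | false = rv

forward-occupied : ∀ {N} {o : Occ} i v → o (forward N o v i) ≡ true →
                   ∀ j → j < i → o (advance N j v) ≡ true
forward-occupied {N} {o} (suc i) v eq j j<i with o v in ov | j | j<i
... | true | zero | _ = ov
... | true | suc j′ | s≤s j′<i = forward-occupied {N} {o} i (next N v) eq j′ j′<i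
... | false | _ | _ = contradiction (trans (sym ov) eq) λ ()

forward-finds-vacancy : ∀ {N} {o : Occ} {v w} → InRange N v → InRange N w → o w ≡ false →
                        o (forward N o v N) ≡ false
forward-finds-vacancy {N} {o} {v} rv rw ow with o (forward N o v N) in eq
... | false = refl
... | true with advance-reaches rv rw
...   | j , j<N , reaches = trans (sym (forward-occupied {N} {o} N v eq j j<N)) (trans (cong o reaches) ow)

backward-finds-vacancy : ∀ {N o w} j v → InRange N v → backward N o v j ≡ just w →
                         InRange N w × o w ≡ false
backward-finds-vacancy {N} {o} (suc j) v rv eq with o (prev N v) in ov
... | true = backward-finds-vacancy j (prev N v) (prev-inRange rv) eq
... | false with eq
...   | refl = prev-inRange rv , ov

parkCircular-inRange : ∀ {N k o} a → InRange N a → InRange N (parkCircular N k o a)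
parkCircular-inRange {N} {k} {o} a ra with o a
... | false = ra
... | true with backward N o a k in eq
...   | just w = proj₁ (backward-finds-vacancy k a ra eq)
...   | nothing = forward-inRange N a ra

parkCircular-finds-vacancy : ∀ {N k} {o : Occ} {a w} → InRange N a → InRange N w → o w ≡ false →
                             o (parkCircular N k o a) ≡ false
parkCircular-finds-vacancy {N} {k} {o} {a} ra rw ow with o a in oa
... | false = oa
... | true with backward N o a k in eq
...   | just _ = proj₂ (backward-finds-vacancy k a ra eq)
...   | nothing = forward-finds-vacancy ra rw ow

runCircular-preserves : ∀ {N k} (o : Occ) {v} t → o v ≡ true → runCircular N k o t v ≡ true
runCircular-preserves o [] ov = ov
runCircular-preserves o (a ∷ t) ov = runCircular-preserves _ t (occupy-preserves o ov)

occupy-arrival : ∀ {N k} (o : Occ) a → occupy (parkCircular N k o a) o a ≡ true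
occupy-arrival {N} {k} o a = by-occupancy (o a) refl
  where
  by-occupancy : ∀ b → o a ≡ b → occupy (parkCircular N k o a) o a ≡ true
  by-occupancy true oa = occupy-preserves o oa
  by-occupancy false oa =
    trans (cong (λ c → occupy c o a) (parkCircular-at-vacant {N} {k} {o} oa)) (occupy-self o a)

runCircular-fills : ∀ {N k} (o : Occ) t → N ∈ t → runCircular N k o t N ≡ true
runCircular-fills {k = k} o (a ∷ t) (here refl) = runCircular-preserves _ t (occupy-arrival {k = k} o a)
runCircular-fills o (a ∷ t) (there N∈t) = runCircular-fills _ t N∈t

Rotated : ℕ → Occ → Occ → Set
Rotated N o′ o = ∀ v → InRange N v → o′ (next N v) ≡ o v

module _ {N : ℕ} {o′ o : Occ} (rot : Rotated N o′ o) where

  forward-rotate : ∀ i v → InRange N v → forward N o′ (next N v) i ≡ next N (forward N o v i)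
  forward-rotate zero v rv = refl
  forward-rotate (suc i) v rv rewrite rot v rv with o v
  ... | true = forward-rotate i (next N v) (next-inRange v (InRange⇒1≤N rv))
  ... | false = refl

  backward-rotate : ∀ j v → InRange N v → backward N o′ (next N v) j ≡ mapMaybe (next N) (backward N o v j)
  backward-rotate zero v rv = refl
  backward-rotate (suc j) v rv rewrite prev-next rv = step (prev N v) v (prev-inRange rv) (next-prev rv)
    where
    step : ∀ u w → InRange N u → next N u ≡ w →
           (if o′ w then backward N o′ w j else just w) ≡
           mapMaybe (next N) (if o u then backward N o u j else just u)
    step u _ ru refl rewrite rot u ru with o u
    ... | true = backward-rotate j u ru
    ... | false = refl

  parkCircular-rotate : ∀ k a → InRange N a → parkCircular N k o′ (next N a) ≡ next N (parkCircular N k o a)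
  parkCircular-rotate k a ra rewrite rot a ra with o a
  ... | false = refl
  ... | true = trans (cong₂ fromMaybe (forward-rotate N a ra) (backward-rotate k a ra))
                     (fromMaybe-map (backward N o a k))
    where
    fromMaybe-map : ∀ m → fromMaybe (next N (forward N o a N)) (mapMaybe (next N) m)
                          ≡ next N (fromMaybe (forward N o a N) m)
    fromMaybe-map (just _) = refl
    fromMaybe-map nothing = refl

occupy-rotate : ∀ {N o′ o v} → Rotated N o′ o → InRange N v → Rotated N (occupy (next N v) o′) (occupy v o)
occupy-rotate rot rv w rw rewrite next-≡ᵇ rw rv | rot w rw = refl

runCircular-rotate : ∀ {N k o′ o} t → Rotated N o′ o → All (InRange N) t →
                     Rotated N (runCircular N k o′ (rotate N t)) (runCircular N k o t)
runCircular-rotate [] rot [] = rot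
runCircular-rotate {N} {k} {o′} {o} (a ∷ t) rot (ra ∷ rt) =
  subst (λ c → Rotated N (runCircular N k (occupy c o′) (rotate N t)) (runCircular N k (occupy c′ o) t))
        (sym (parkCircular-rotate {o′ = o′} {o} rot k a ra))
        (runCircular-rotate {k = k} t (occupy-rotate {o′ = o′} {o} rot c′-inRange) rt)
  where
  c′ = parkCircular N k o a
  c′-inRange = parkCircular-inRange {k = k} {o} a ra

-- Every car parks on the cycle

vacancy : Bool → ℕ
vacancy b = if b then 0 else 1

emptyCount : ℕ → Occ → ℕ
emptyCount N o = sumOver (range1 N) (vacancy ∘ o)

emptyCount-emptyOcc : ∀ N → emptyCount N emptyOcc ≡ N
emptyCount-emptyOcc N = trans (sumOver-range1-const N 1) (*-identityʳ N)

emptyCount≢0⇒vacancy : ∀ {N o} → emptyCount N o ≢ 0 → Σ[ w ∈ ℕ ] InRange N w × o w ≡ false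
emptyCount≢0⇒vacancy {N} {o} ne
  with lookupAny (range1-inRange N) (sumOver-nonzero (range1 N) (vacancy ∘ o) ne)
... | rw , vacant = _ , rw , vacancy≢0⇒false vacant
  where
  vacancy≢0⇒false : ∀ {b} → vacancy b ≢ 0 → b ≡ false
  vacancy≢0⇒false {false} _ = refl
  vacancy≢0⇒false {true} ne = contradiction refl ne

emptyCount-occupy-≤ : ∀ N o v → emptyCount N (occupy v o) ≤ emptyCount N o
emptyCount-occupy-≤ N o v = sumOver-mono-≤ (range1 N) vacancy-occupy
  where
  vacancy-occupy : ∀ w → vacancy (occupy v o w) ≤ vacancy (o w)
  vacancy-occupy w with w ≡ᵇ v
  ... | true = z≤n
  ... | false = ≤-refl

emptyCount-occupy-beyond : ∀ {N o v} → N < v → emptyCount N (occupy v o) ≡ emptyCount N o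
emptyCount-occupy-beyond {N} {o} N<v = sumOver-cong-local (range1-inRange N)
  (λ (_ , w≤N) → cong vacancy (occupy-other o (<⇒≢ (≤-<-trans w≤N N<v))))

emptyCount-occupy-vacant : ∀ {N o v} → InRange N v → o v ≡ false →
                           suc (emptyCount N (occupy v o)) ≡ emptyCount N o
emptyCount-occupy-vacant {zero} (s≤s _ , ())
emptyCount-occupy-vacant {suc n} {o} {v} (1≤v , v≤1+n) ov
  rewrite sumOver-range1-snoc n (vacancy ∘ occupy v o) | sumOver-range1-snoc n (vacancy ∘ o)
  with m≤n⇒m<n∨m≡n v≤1+n
... | inj₁ (s≤s v≤n) rewrite occupy-other o {v} {suc n} (<⇒≢ (s≤s v≤n) ∘ sym) =
  cong (_+ vacancy (o (suc n))) (emptyCount-occupy-vacant (1≤v , v≤n) ov)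
... | inj₂ refl rewrite occupy-self o (suc n) | ov | emptyCount-occupy-beyond {n} {o} ≤-refl =
  trans (cong suc (+-identityʳ _)) (+-comm 1 _)

-- On a full cycle the car lands on an occupied vertex and the count stays 0.
emptyCount-park : ∀ {N k o} a → InRange N a →
                  emptyCount N (occupy (parkCircular N k o a) o) ≡ emptyCount N o ∸ 1
emptyCount-park {N} {k} {o} a ra with emptyCount N o in eq
... | zero = n≤0⇒n≡0 (subst (emptyCount N (occupy (parkCircular N k o a) o) ≤_) eq
                              (emptyCount-occupy-≤ N o _))
... | suc c with emptyCount≢0⇒vacancy {N} {o} (λ eq′ → contradiction (trans (sym eq) eq′) λ ())
...   | w , rw , ow = suc-injective (trans (emptyCount-occupy-vacant lands-inRange lands-vacant) eq)
  where
  lands-inRange = parkCircular-inRange {k = k} {o} a ra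
  lands-vacant = parkCircular-finds-vacancy {k = k} {o} ra rw ow

emptyCount-runCircular : ∀ {N k} o t → All (InRange N) t →
                         emptyCount N (runCircular N k o t) ≡ emptyCount N o ∸ length t
emptyCount-runCircular o [] [] = refl
emptyCount-runCircular {N} {k} o (a ∷ t) (ra ∷ rt) =
  trans (emptyCount-runCircular _ t rt)
        (trans (cong (_∸ length t) (emptyCount-park {k = k} {o} a ra))
               (∸-+-assoc (emptyCount N o) 1 (length t)))

-- Double counting over the vertices of the cycle

tiesLeavingEmpty : ℕ → ℕ → ℕ → ℕ → ℕ
tiesLeavingEmpty N k m v = sumOver (tuples m N) (λ t → ties t * vacancy (runCircular N k emptyOcc t v))

tiesLeavingEmpty-next : ∀ N k m {v} → InRange N v → tiesLeavingEmpty N k m (next N v) ≡ tiesLeavingEmpty N k m v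
tiesLeavingEmpty-next N k m {v} rv =
  trans (sym (sumOver-tuples-rotate m N _))
        (sumOver-cong-local (tuples-inRange m N) λ {t} rt →
          cong₂ _*_ (ties-rotate t rt) (cong vacancy (runCircular-rotate {k = k} t (λ _ _ → refl) rt v rv)))

tiesLeavingEmpty-constant : ∀ N k m v → InRange N v → tiesLeavingEmpty N k m v ≡ tiesLeavingEmpty N k m N
tiesLeavingEmpty-constant N k m (suc zero) (_ , 1≤N) =
  trans (cong (tiesLeavingEmpty N k m) (sym (next-last N))) (tiesLeavingEmpty-next N k m (1≤N , ≤-refl))
tiesLeavingEmpty-constant N k m (suc (suc w)) (_ , w<N) =
  trans (cong (tiesLeavingEmpty N k m) (sym (next-< w<N)))
        (trans (tiesLeavingEmpty-next N k m rw) (tiesLeavingEmpty-constant N k m (suc w) rw))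
  where rw = s≤s z≤n , <⇒≤ w<N

tiesLeavingEmpty-total : ∀ N k m →
  N * tiesLeavingEmpty N k m N ≡ sumOver (tuples m N) (λ t → ties t * (N ∸ length t))
tiesLeavingEmpty-total N k m = begin
  N * tiesLeavingEmpty N k m N
    ≡⟨ sym (sumOver-range1-const N _) ⟩
  sumOver (range1 N) (λ _ → tiesLeavingEmpty N k m N)
    ≡⟨ sym (sumOver-cong-local (range1-inRange N) (tiesLeavingEmpty-constant N k m _)) ⟩
  sumOver (range1 N) (tiesLeavingEmpty N k m)
    ≡⟨ sumOver-swap (range1 N) (tuples m N) _ ⟩
  sumOver (tuples m N) (λ t → sumOver (range1 N) (λ v → ties t * vacancy (runCircular N k emptyOcc t v)))
    ≡⟨ sumOver-cong-local (tuples-inRange m N) (λ {t} rt →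
         trans (sumOver-*ˡ (range1 N) (ties t) _) (cong (ties t *_) (emptyCount-final t rt))) ⟩
  sumOver (tuples m N) (λ t → ties t * (N ∸ length t)) ∎
  where
  open ≡-Reasoning
  emptyCount-final : ∀ t → All (InRange N) t → emptyCount N (runCircular N k emptyOcc t) ≡ N ∸ length t
  emptyCount-final t rt =
    trans (emptyCount-runCircular emptyOcc t rt) (cong (_∸ length t) (emptyCount-emptyOcc N))

tiesLeavingEmpty-independent : ∀ n k k′ m →
  tiesLeavingEmpty (suc n) k m (suc n) ≡ tiesLeavingEmpty (suc n) k′ m (suc n)
tiesLeavingEmpty-independent n k k′ m = *-cancelˡ-≡ _ _ (suc n)
  (trans (tiesLeavingEmpty-total (suc n) k m) (sym (tiesLeavingEmpty-total (suc n) k′ m)))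

-- Comparison with the rule on the path

admissible : ℕ → Occ → ℕ → Bool
admissible k o a = not (a ≤ᵇ k) ∨ someFreeUpTo o a

parkB : ℕ → ℕ → Occ → ℕ → Maybe ℕ
parkB n k o a = if admissible k o a then parkNaples n k o a else nothing

runsB : ℕ → ℕ → Occ → List ℕ → Bool
runsB n k o [] = true
runsB n k o (a ∷ t) = maybe′ (λ v → runsB n k (occupy v o) t) false (parkB n k o a)

parks∧bCond≡runsB : ∀ n k o t → isJust (runRule (parkNaples n k) o t) ∧ bCond n k o t ≡ runsB n k o t
parks∧bCond≡runsB n k o [] = refl
parks∧bCond≡runsB n k o (a ∷ t) with parkNaples n k o a
... | nothing with admissible k o a
...   | true = refl
...   | false = refl
parks∧bCond≡runsB n k o (a ∷ t) | just v with admissible k o a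
...   | true = parks∧bCond≡runsB n k (occupy v o) t
...   | false = ∧-zeroʳ _

-- A car that fails on the path [n] is matched by a car taking vertex n + 1 of the cycle.
SameSpot : ℕ → Maybe ℕ → ℕ → Set
SameSpot n (just v) c = c ≡ v × InRange n v
SameSpot n nothing c = c ≡ suc n

freeAt-inRange : ∀ {n} {o : Occ} {a} → InRange n a → freeAt n o a ≡ not (o a)
freeAt-inRange (1≤a , a≤n) rewrite ≤ᵇ-true 1≤a | ≤ᵇ-true a≤n = refl

freeAt-beyond : ∀ {n} {o : Occ} {a} → n < a → freeAt n o a ≡ false
freeAt-beyond {n} {o} {suc a} n<a rewrite ≤ᵇ-false (<⇒≱ n<a) = refl

firstFreeFrom-beyond : ∀ {n} {o : Occ} v i → n < v → firstFreeFrom n o v i ≡ nothing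
firstFreeFrom-beyond v zero _ = refl
firstFreeFrom-beyond {n} {o} v (suc i) n<v rewrite freeAt-beyond {o = o} n<v =
  firstFreeFrom-beyond (suc v) i (m<n⇒m<1+n n<v)

forward-firstFreeFrom : ∀ {n} {o : Occ} → o (suc n) ≡ false → ∀ i v → InRange n v → suc n ≤ v + i →
                        SameSpot n (firstFreeFrom n o v i) (forward (suc n) o v i)
forward-firstFreeFrom {n} oN zero v (_ , v≤n) n<v+0 =
  contradiction (subst (suc n ≤_) (+-identityʳ v) n<v+0) (≤⇒≯ v≤n)
forward-firstFreeFrom {n} {o} oN (suc i) v rv n<v+i rewrite freeAt-inRange {o = o} rv with o v
... | false = refl , rv
... | true rewrite next-< {suc n} {v} (s≤s (proj₂ rv)) with suc v ≤? n
...   | yes v<n = forward-firstFreeFrom oN i (suc v) (s≤s z≤n , v<n) (subst (suc n ≤_) (+-suc v i) n<v+i)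
...   | no v≮n rewrite firstFreeFrom-beyond {o = o} (suc v) i (≰⇒> v≮n)
                     | ≤-antisym (≰⇒> v≮n) (s≤s (proj₂ rv)) = forward-at-vacant oN i

someFreeUpTo-true : ∀ {o : Occ} {w} a → InRange a w → o w ≡ false → someFreeUpTo o a ≡ true
someFreeUpTo-true zero (s≤s _ , ()) _
someFreeUpTo-true {o} (suc a) (1≤w , w≤1+a) ow with m≤n⇒m<n∨m≡n w≤1+a
... | inj₂ refl rewrite ow = refl
... | inj₁ (s≤s w≤a) = trans (cong (not (o (suc a)) ∨_) (someFreeUpTo-true a (1≤w , w≤a) ow)) (∨-zeroʳ _)

someFreeUpTo-false : ∀ {o : Occ} a → (∀ {i} → InRange a i → o i ≡ true) → someFreeUpTo o a ≡ false
someFreeUpTo-false zero full = refl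
someFreeUpTo-false {o} (suc a) full rewrite full (s≤s z≤n , ≤-refl) =
  someFreeUpTo-false a (λ (1≤i , i≤a) → full (1≤i , m≤n⇒m≤1+n i≤a))

data BackwardOutcome (n : ℕ) (o : Occ) (a : ℕ) : Maybe ℕ → Maybe ℕ → ℕ → Set where
  found     : ∀ {w s} → InRange n w → someFreeUpTo o a ≡ true → BackwardOutcome n o a (just w) (just w) s
  exhausted : ∀ {s} → s < a → BackwardOutcome n o a nothing nothing s
  wrapped   : ∀ {s} → a ≤ s → someFreeUpTo o a ≡ false → BackwardOutcome n o a nothing (just (suc n)) s

backFree-beyond : ∀ {n} {o : Occ} {a} j d → a ∸ 1 < d → backFree n o a j d ≡ nothing
backFree-beyond zero d _ = refl
backFree-beyond {n} {o} {a} (suc j) d a∸1<d rewrite ≤ᵇ-false (<⇒≱ a∸1<d) =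
  backFree-beyond {n} {o} {a} j (suc d) (m<n⇒m<1+n a∸1<d)

-- After e steps both backward searches stand at x + 1 = a − e; they agree until the
-- cyclic one wraps from 1 to n + 1, which happens only when 1, …, a are all occupied.
backward-search : ∀ {n} {o : Occ} {a} → o (suc n) ≡ false → InRange n a → ∀ j e x → a ≡ suc x + e →
                  (∀ i → suc x ≤ i → i ≤ a → o i ≡ true) →
                  BackwardOutcome n o a (backFree n o a j (suc e)) (backward (suc n) o (suc x) j) (j + e)
backward-search oN ra zero e x refl full = exhausted (s≤s (m≤n+m e x))
backward-search {n} {o} oN ra (suc j) e zero refl full
  rewrite ≤ᵇ-false (n≮n e) | backFree-beyond {n} {o} {suc e} j (suc (suc e)) (m<n⇒m<1+n ≤-refl) | oN =
  wrapped (s≤s (m≤n+m e j)) (someFreeUpTo-false (suc e) λ (1≤i , i≤a) → full _ 1≤i i≤a)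
backward-search {n} {o} oN ra (suc j) e (suc y) refl full
  rewrite ≤ᵇ-true (s≤s (m≤n+m e y)) | m+n∸n≡m (suc y) e
        | freeAt-inRange {o = o} (s≤s z≤n , ≤-trans (m≤n⇒m≤1+n (m≤m+n (suc y) e)) (proj₂ ra))
  with o (suc y) in oy
... | false = found (s≤s z≤n , ≤-trans (m≤n⇒m≤1+n (m≤m+n (suc y) e)) (proj₂ ra))
                    (someFreeUpTo-true {o} (suc (suc y) + e) (s≤s z≤n , m≤n⇒m≤1+n (m≤m+n (suc y) e)) oy)
... | true = subst (BackwardOutcome n o _ _ _) (+-suc j e)
               (backward-search {n} {o} oN ra j (suc e) y (cong suc (sym (+-suc y e))) full′)
  where
  full′ : ∀ i → suc y ≤ i → i ≤ suc (suc y) + e → o i ≡ true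
  full′ i y<i i≤a with m≤n⇒m<n∨m≡n y<i
  ... | inj₁ y+1<i = full i y+1<i i≤a
  ... | inj₂ refl = oy

backward-search-from : ∀ {n} {o : Occ} {a} k → o (suc n) ≡ false → InRange n a → o a ≡ true →
                       BackwardOutcome n o a (backFree n o a k 1) (backward (suc n) o a k) k
backward-search-from {a = zero} k oN (() , _) oa
backward-search-from {n} {o} {suc x} k oN ra oa =
  subst (BackwardOutcome _ _ _ _ _) (+-identityʳ k) (backward-search oN ra k 0 x (sym (+-identityʳ _)) full)
  where
  full : ∀ i → suc x ≤ i → i ≤ suc x → o i ≡ true
  full i x<i i≤a = subst (λ i → o i ≡ true) (≤-antisym x<i i≤a) oa

parkNaples-free : ∀ {n k o a} → freeAt n o a ≡ true → parkNaples n k o a ≡ just a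
parkNaples-free eq rewrite eq = refl

parkNaples-occupied : ∀ {n k o a} → freeAt n o a ≡ false →
                      parkNaples n k o a ≡ (backFree n o a k 1 <∣> parkClassical n o a)
parkNaples-occupied {n} {k} {o} {a} eq rewrite eq with backFree n o a k 1
... | just _ = refl
... | nothing rewrite eq = refl

parkB-at-vacant : ∀ {n k o a} → InRange n a → o a ≡ false → parkB n k o a ≡ just a
parkB-at-vacant {n} {k} {o} {a} ra@(1≤a , _) oa =
  trans (cong (λ b → if b then parkNaples n k o a else nothing) admissible-at-vacant)
        (parkNaples-free {n} {k} {o} (trans (freeAt-inRange {o = o} ra) (cong not oa)))
  where
  admissible-at-vacant : admissible k o a ≡ true
  admissible-at-vacant = trans (cong (not (a ≤ᵇ k) ∨_) (someFreeUpTo-true a (1≤a , ≤-refl) oa)) (∨-zeroʳ _)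

parkB-at-occupied : ∀ {n k o a} → InRange n a → o a ≡ true →
  parkB n k o a ≡ (if admissible k o a then backFree n o a k 1 <∣> parkClassical n o a else nothing)
parkB-at-occupied {n} {k} {o} {a} ra oa = cong (if admissible k o a then_else nothing)
  (parkNaples-occupied {n} {k} {o} (trans (freeAt-inRange {o = o} ra) (cong not oa)))

parkB-circular : ∀ {n k o a} → o (suc n) ≡ false → InRange n a →
                 SameSpot n (parkB n k o a) (parkCircular (suc n) k o a)
parkB-circular {n} {k} {o} {a} oN ra = by-occupancy (o a) refl
  where
  occupied : o a ≡ true →
             SameSpot n (if admissible k o a then backFree n o a k 1 <∣> parkClassical n o a else nothing)
                        (fromMaybe (forward (suc n) o a (suc n)) (backward (suc n) o a k))
  occupied oa with backFree n o a k 1 | backward (suc n) o a k | backward-search-from {n} {o} {a} k oN ra oa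
  ... | just w | just w | found rw free rewrite free | ∨-zeroʳ (not (a ≤ᵇ k)) = refl , rw
  ... | nothing | nothing | exhausted k<a rewrite ≤ᵇ-false (<⇒≱ k<a) =
    forward-firstFreeFrom oN (suc n) a ra (m≤n+m (suc n) a)
  ... | nothing | just _ | wrapped a≤k full rewrite ≤ᵇ-true a≤k | full = refl

  by-occupancy : ∀ b → o a ≡ b → SameSpot n (parkB n k o a) (parkCircular (suc n) k o a)
  by-occupancy false oa = subst₂ (SameSpot n) (sym (parkB-at-vacant {n} {k} {o} ra oa))
                                 (sym (parkCircular-at-vacant {suc n} {k} {o} oa)) (refl , ra)
  by-occupancy true oa = subst₂ (SameSpot n) (sym (parkB-at-occupied {n} {k} {o} ra oa))
                                (sym (parkCircular-at-occupied {suc n} {k} {o} oa)) (occupied oa)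

runsB-circular : ∀ {n k} (o : Occ) t → o (suc n) ≡ false → All (InRange n) t →
                 runsB n k o t ≡ not (runCircular (suc n) k o t (suc n))
runsB-circular o [] oN [] rewrite oN = refl
runsB-circular {n} {k} o (a ∷ t) oN (ra ∷ rt) with parkB n k o a | parkB-circular {n} {k} {o} {a} oN ra
... | just v | c≡v , (_ , v≤n) rewrite c≡v =
  runsB-circular (occupy v o) t (trans (occupy-other o (<⇒≢ (s≤s v≤n) ∘ sym)) oN) rt
... | nothing | c≡N rewrite c≡N = cong not (sym (runCircular-preserves _ t (occupy-self o (suc n))))

if-not≡*vacancy : ∀ b x → (if not b then x else 0) ≡ x * vacancy b
if-not≡*vacancy true x = sym (*-zeroʳ x)
if-not≡*vacancy false x = sym (*-identityʳ x)

tiesB≡tiesLeavingEmpty : ∀ m n k → tiesB m n k ≡ tiesLeavingEmpty (suc n) k m (suc n)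
tiesB≡tiesLeavingEmpty m n k = begin
  tiesB m n k
    ≡⟨ sumTiesOver≡sumOver (isB n k) (tuples m n) ⟩
  sumOver (tuples m n) (λ t → if isB n k t then ties t else 0)
    ≡⟨ sumOver-cong-local (tuples-inRange m n) (λ {t} rt →
         trans (cong (λ b → if b then ties t else 0) (isB-circular t rt)) (if-not≡*vacancy _ (ties t))) ⟩
  sumOver (tuples m n) (λ t → ties t * vacancy (runCircular (suc n) k emptyOcc t (suc n)))
    ≡⟨ sym (sumOver-tuples-restrict m n _ filled) ⟩
  tiesLeavingEmpty (suc n) k m (suc n) ∎
  where
  open ≡-Reasoning
  isB-circular : ∀ t → All (InRange n) t → isB n k t ≡ not (runCircular (suc n) k emptyOcc t (suc n))
  isB-circular t rt = trans (parks∧bCond≡runsB n k emptyOcc t) (runsB-circular emptyOcc t refl rt)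
  filled : ∀ t → All (InRange (suc n)) t → suc n ∈ t →
           ties t * vacancy (runCircular (suc n) k emptyOcc t (suc n)) ≡ 0
  filled t _ n+1∈t rewrite runCircular-fills {k = k} emptyOcc t n+1∈t = *-zeroʳ (ties t)

-- B(m,n;0) = PF(m,n)

parkNaples-zero : ∀ n o a → parkNaples n 0 o a ≡ parkClassical n o a
parkNaples-zero n o a with freeAt n o a in eq
... | true = refl
... | false rewrite eq = refl

runRule-cong : ∀ {rule rule′ : Occ → ℕ → Maybe ℕ} → (∀ o a → rule o a ≡ rule′ o a) →
               ∀ o t → runRule rule o t ≡ runRule rule′ o t
runRule-cong same o [] = refl
runRule-cong {rule} {rule′} same o (a ∷ t) rewrite same o a with rule′ o a
... | nothing = refl
... | just v = runRule-cong same (occupy v o) t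

bCond-zero : ∀ n o t → All (InRange n) t → bCond n 0 o t ≡ isJust (runRule (parkNaples n 0) o t)
bCond-zero n o [] [] = refl
bCond-zero n o (a ∷ t) ((1≤a , _) ∷ rt) with parkNaples n 0 o a
... | nothing = refl
... | just v rewrite ≤ᵇ-false (<⇒≱ 1≤a) = bCond-zero n (occupy v o) t rt

isB-zero : ∀ n t → All (InRange n) t → isB n 0 t ≡ isPF n t
isB-zero n t rt = begin
  isPFk n 0 t ∧ bCond n 0 emptyOcc t ≡⟨ cong (isPFk n 0 t ∧_) (bCond-zero n emptyOcc t rt) ⟩
  isPFk n 0 t ∧ isPFk n 0 t          ≡⟨ ∧-idem _ ⟩
  isPFk n 0 t                        ≡⟨ cong isJust (runRule-cong (parkNaples-zero n) emptyOcc t) ⟩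
  isPF n t                           ∎
  where open ≡-Reasoning

tiesB-zero : ∀ m n → tiesB m n 0 ≡ tiesPF m n
tiesB-zero m n = sumTiesOver-cong-local (tuples-inRange m n) (isB-zero n _)

corollary1 : (m n k : ℕ) → 1 ≤ m → m ≤ n → k < n → tiesB m n k ≡ tiesPF m n
corollary1 m n k _ _ _ = begin
  tiesB m n k                          ≡⟨ tiesB≡tiesLeavingEmpty m n k ⟩
  tiesLeavingEmpty (suc n) k m (suc n) ≡⟨ tiesLeavingEmpty-independent n k 0 m ⟩
  tiesLeavingEmpty (suc n) 0 m (suc n) ≡⟨ sym (tiesB≡tiesLeavingEmpty m n 0) ⟩
  tiesB m n 0                          ≡⟨ tiesB-zero m n ⟩
  tiesPF m n                           ∎
  where open ≡-Reasoning
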